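{- Let $r,c$ be odd positive integers, let $h$ be a white vertex of the $r\times c$ grid graph, and let $a(r,c;h)$ be the number of near-perfect matchings of the grid in which $h$ is unmatched. (a) If both $r$ and $c$ are congruent to $3$ mod $4$, then $a(r,c;h)$ is even. (b) If $\gcd(r+1,c+1)$ is divisible by some odd integer $f>1$, then $a(r,c;h)$ is even.
   Context: The $r\times c$ grid graph has vertex set $\{1,\dots,r\}\times\{1,\dots,c\}$, with two vertices adjacent when they differ by $1$ in exactly one coordinate. A near-perfect matching is a set of pairwise disjoint edges covering all vertices but one. With $r,c$ odd, a vertex $(i,j)$ is white if $i+j$ is even (the majority color of the checkerboard coloring), and black otherwise. -}

module Defs where

open import Data.Nat using (ℕ; zero; suc; _+_; _≡ᵇ_)
open import Data.Bool using (Bool; true; false; _∧_; _∨_; not; if_then_else_)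
open import Data.List using (List; []; _∷_; _++_; map; concatMap; length; filterᵇ; upTo)
open import Data.Product using (_×_; _,_)

-- Vertices of the r × c grid: pairs (i , j) with 1 ≤ i ≤ r, 1 ≤ j ≤ c.
Vertex : Set
Vertex = ℕ × ℕ

Edge : Set
Edge = Vertex × Vertex

range1 : ℕ → List ℕ
range1 n = map suc (upTo n)

vertices : ℕ → ℕ → List Vertex
vertices r c = concatMap (λ i → map (λ j → (i , j)) (range1 c)) (range1 r)

horizontal : ℕ → ℕ → List Edge
horizontal r c = concatMap (λ i → map (λ j → ((i , j) , (i , suc j))) (range1 (c Data.Nat.∸ 1))) (range1 r)

vertical : ℕ → ℕ → List Edge
vertical r c = concatMap (λ i → map (λ j → ((i , j) , (suc i , j))) (range1 c)) (range1 (r Data.Nat.∸ 1))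

gridEdges : ℕ → ℕ → List Edge
gridEdges r c = horizontal r c ++ vertical r c

allB : {A : Set} → (A → Bool) → List A → Bool
allB p [] = true
allB p (x ∷ xs) = p x ∧ allB p xs

-- all sub-lists (= all subsets of a duplicate-free list)
subsets : {A : Set} → List A → List (List A)
subsets [] = [] ∷ []
subsets (x ∷ xs) = let s = subsets xs in s ++ map (x ∷_) s

_≟v_ : Vertex → Vertex → Bool
(a , b) ≟v (c , d) = (a ≡ᵇ c) ∧ (b ≡ᵇ d)

incident : Vertex → Edge → Bool
incident v (x , y) = (v ≟v x) ∨ (v ≟v y)

degIn : List Edge → Vertex → ℕ
degIn M v = length (filterᵇ (incident v) M)

isNPMmissing : ℕ → ℕ → Vertex → List Edge → Bool
isNPMmissing r c h M =
  allB (λ v → if v ≟v h then degIn M v ≡ᵇ 0 else degIn M v ≡ᵇ 1) (vertices r c)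

a : ℕ → ℕ → Vertex → ℕ
a r c h = length (filterᵇ (isNPMmissing r c h) (subsets (gridEdges r c)))

{-# OPTIONS --safe #-}

-- A near-perfect matching missing h is a spanning subgraph with degree 1 - δ_h. Let S be a set of
-- vertices containing some s₀ but not h, such that every vertex has an even number of neighbours
-- in S, and let P u count the subgraphs of degree 1 - δ_h - δ_{s₀} - δ_u. Expanding over the edge
-- at s₀ shows that ∑_{u ~ s₀} P u is the number of near-perfect matchings missing h; for any other
-- s ∈ S, ∑_{u ~ s} P u counts subgraphs of degree 2 at s with one of their two edges at s marked,
-- hence is even. So the count is congruent mod 2 to ∑_{s ∈ S} ∑_{u ~ s} P u = ∑_u P u |N(u) ∩ S|,
-- which is even.
--
-- On the r × c grid take N = 2 gcd(r + 1, c + 1) and let S consist of the (i , j) for which exactly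
-- one of i + j and i - j is ±1 mod N. On the frame around the grid (i ∈ {0, r + 1} or
-- j ∈ {0, c + 1}) the numbers i + j and i - j agree mod N up to sign, since N divides 2 (r + 1) and
-- 2 (c + 1); so S misses the frame. In the coordinates (i + j , i - j) the four neighbours of (i , j)
-- are the corners (i + j ± 1 , i - j ± 1), so every grid vertex has an even number of them in S.
-- A white h has i ± j even, so h ∉ S as N is even; and (1 , 2) ∈ S as soon as N > 4, that is
-- gcd(r + 1, c + 1) > 2, which is what hypotheses (a) and (b) provide.

module Submission where

open import Defs
open import Data.Bool using (Bool; true; false; _∧_; _∨_; not; if_then_else_; _xor_)
open import Data.Bool.Properties using (∧-identityʳ; ∧-zeroʳ; ∨-comm; ∨-zeroʳ; xor-same)
open import Data.Integer as ℤ using (ℤ; +_; -_; _-_; +≤+; -≤+; -<+)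
import Data.Integer.Properties as ℤ
open import Data.Integer.Divisibility.Signed as ℤ using () renaming (_∣_ to _∣ℤ_; _∣?_ to _∣ℤ?_)
open import Data.Integer.Tactic.RingSolver using () renaming (solve-∀ to ℤ-solve-∀)
open import Data.List using (List; []; _∷_; _++_; map; concatMap; length; filterᵇ; cartesianProduct)
open import Data.List.Properties using (map-concatMap; concatMap-cong; map-∘)
open import Data.List.Membership.Propositional using (_∈_; _∉_)
open import Data.List.Membership.Propositional.Properties using (∈-map⁺; ∈-map⁻; ∈-upTo⁺; ∈-upTo⁻)
open import Data.List.Relation.Unary.All as All using (All; []; _∷_)
import Data.List.Relation.Unary.All.Properties as All
open import Data.List.Relation.Unary.Any as Any using (here; there)
import Data.List.Relation.Unary.Any.Properties as Any
open import Data.List.Relation.Unary.Unique.Propositional using (Unique; []; _∷_)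
import Data.List.Relation.Unary.Unique.Propositional.Properties as Unique
open import Data.Nat as ℕ using (ℕ; zero; suc; _+_; _*_; _∸_; _%_; _<_; _≤_; _≡ᵇ_; z≤n; s≤s; ≢-nonZero)
import Data.Nat.Properties as ℕ
open import Data.Nat.DivMod using (%-distribˡ-+)
open import Data.Nat.Divisibility
  using (_∣_; divides; _∣0; ∣m∣n⇒∣m+n; m∣m*n; ∣n⇒∣m*n; ∣m+n∣m⇒∣n; ∣⇒≤; *-monoʳ-∣; m%n≡0⇒n∣m)
open import Data.Nat.GCD using (gcd; gcd[m,n]∣m; gcd[m,n]∣n; gcd[m,n]≢0; gcd-greatest)
open import Data.Nat.Tactic.RingSolver using (solve-∀)
open import Data.Product using (_×_; _,_; proj₁; proj₂; ∃-syntax)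
open import Data.Product.Properties using (,-injective)
open import Data.Sum using (_⊎_; inj₁; inj₂)
open import Function using (_∘_; flip)
open import Function.Bundles using (_⇔_; mk⇔)
open import Relation.Binary.Definitions using (DecidableEquality)
open import Relation.Binary.PropositionalEquality
open import Relation.Nullary using (¬_; does; proof; yes; no; _×-dec_; map′; contradiction)
open import Relation.Nullary.Decidable using (dec-true; dec-false; does-⇔)
open import Relation.Nullary.Reflects using (Reflects; ofʸ; ofⁿ)

private variable
  A B : Set

-- Finite sums

∑ : List A → (A → ℕ) → ℕ
∑ []       f = 0
∑ (x ∷ xs) f = f x + ∑ xs f

infix 5 ∑
syntax ∑ xs (λ x → e) = ∑[ x ∈ xs ] e

toℕ : Bool → ℕ
toℕ false = 0
toℕ true  = 1

∑-++ : ∀ xs ys (f : A → ℕ) → ∑ (xs ++ ys) f ≡ ∑ xs f + ∑ ys f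
∑-++ []       ys f = refl
∑-++ (x ∷ xs) ys f = trans (cong (f x ℕ.+_) (∑-++ xs ys f)) (sym (ℕ.+-assoc (f x) _ _))

∑-map : ∀ (g : A → B) xs (f : B → ℕ) → ∑ (map g xs) f ≡ ∑[ x ∈ xs ] f (g x)
∑-map g []       f = refl
∑-map g (x ∷ xs) f = cong (f (g x) ℕ.+_) (∑-map g xs f)

∑-congᴬ : ∀ {xs} {f g : A → ℕ} → All (λ x → f x ≡ g x) xs → ∑ xs f ≡ ∑ xs g
∑-congᴬ []         = refl
∑-congᴬ (fx≡gx ∷ p) = cong₂ _+_ fx≡gx (∑-congᴬ p)

∑-cong : ∀ xs {f g : A → ℕ} → (∀ x → f x ≡ g x) → ∑ xs f ≡ ∑ xs g
∑-cong []       f≗g = refl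
∑-cong (x ∷ xs) f≗g = cong₂ _+_ (f≗g x) (∑-cong xs f≗g)

∑-+ : ∀ xs (f g : A → ℕ) → ∑[ x ∈ xs ] (f x + g x) ≡ ∑ xs f + ∑ xs g
∑-+ []       f g = refl
∑-+ (x ∷ xs) f g = trans (cong (f x + g x ℕ.+_) (∑-+ xs f g)) (interchange (f x) (g x) _ _)
  where
  interchange : ∀ a b c d → a + b + (c + d) ≡ a + c + (b + d)
  interchange = solve-∀

∑-*ˡ : ∀ k xs (f : A → ℕ) → ∑[ x ∈ xs ] (k * f x) ≡ k * ∑ xs f
∑-*ˡ k []       f = sym (ℕ.*-zeroʳ k)
∑-*ˡ k (x ∷ xs) f = trans (cong (k * f x ℕ.+_) (∑-*ˡ k xs f)) (sym (ℕ.*-distribˡ-+ k (f x) _))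

∑-zero : ∀ (xs : List A) → ∑[ x ∈ xs ] 0 ≡ 0
∑-zero []       = refl
∑-zero (x ∷ xs) = ∑-zero xs

∑-comm : ∀ xs ys (f : A → B → ℕ) → ∑[ x ∈ xs ] ∑[ y ∈ ys ] f x y ≡ ∑[ y ∈ ys ] ∑[ x ∈ xs ] f x y
∑-comm []       ys f = sym (∑-zero ys)
∑-comm (x ∷ xs) ys f =
  trans (cong (∑ ys (f x) ℕ.+_) (∑-comm xs ys f)) (sym (∑-+ ys (f x) (λ y → ∑[ x ∈ xs ] f x y)))

∑-even : ∀ {xs} {f : A → ℕ} → All (λ x → 2 ∣ f x) xs → 2 ∣ ∑ xs f
∑-even []         = 2 ∣0
∑-even (2∣fx ∷ p) = ∣m∣n⇒∣m+n 2∣fx (∑-even p)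

∑-sym-even : ∀ xs (f : A → A → ℕ) → (∀ x y → f x y ≡ f y x) → All (λ x → 2 ∣ f x x) xs →
             2 ∣ ∑[ x ∈ xs ] ∑[ y ∈ xs ] f x y
∑-sym-even []       f sym-f []            = 2 ∣0
∑-sym-even (x ∷ xs) f sym-f (2∣fxx ∷ diag) =
  subst (2 ∣_) (sym split) (∣m∣n⇒∣m+n 2∣fxx (∣m∣n⇒∣m+n (m∣m*n (∑ xs (f x))) (∑-sym-even xs f sym-f diag)))
  where
  row : ℕ
  row = ∑ xs (f x)
  rest : ℕ
  rest = ∑[ x′ ∈ xs ] ∑[ y ∈ xs ] f x′ y
  column : ∑[ x′ ∈ xs ] f x′ x ≡ row
  column = ∑-cong xs (λ x′ → sym-f x′ x)
  regroup : ∀ a b c → a + b + (b + c) ≡ a + (2 * b + c)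
  regroup = solve-∀
  split : ∑[ x′ ∈ x ∷ xs ] ∑[ y ∈ x ∷ xs ] f x′ y ≡ f x x + (2 * row + rest)
  split = begin
    f x x + row + (∑[ x′ ∈ xs ] (f x′ x + ∑ xs (f x′)))
      ≡⟨ cong (f x x + row ℕ.+_) (∑-+ xs (λ x′ → f x′ x) (λ x′ → ∑ xs (f x′))) ⟩
    f x x + row + ((∑[ x′ ∈ xs ] f x′ x) + rest)
      ≡⟨ cong (λ z → f x x + row + (z + rest)) column ⟩
    f x x + row + (row + rest)
      ≡⟨ regroup (f x x) row rest ⟩
    f x x + (2 * row + rest) ∎
    where open ≡-Reasoning

module _ (_≟_ : DecidableEquality A) where

  ∑-δ-∉ : ∀ {q} xs (f : A → ℕ) → q ∉ xs → ∑[ x ∈ xs ] toℕ (does (q ≟ x)) * f x ≡ 0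
  ∑-δ-∉ []       f q∉ = refl
  ∑-δ-∉ {q} (x ∷ xs) f q∉ with q ≟ x
  ... | yes refl = contradiction (here refl) q∉
  ... | no _     = ∑-δ-∉ xs f (λ q∈ → q∉ (there q∈))

  ∑-δ : ∀ {q} {xs} (f : A → ℕ) → Unique xs → (q ∉ xs → f q ≡ 0) →
        ∑[ x ∈ xs ] toℕ (does (q ≟ x)) * f x ≡ f q
  ∑-δ {xs = []}     f []             fq≡0 = sym (fq≡0 λ ())
  ∑-δ {q} {x ∷ xs} f (x∉xs ∷ unique) fq≡0 with q ≟ x
  ... | yes refl = trans (cong₂ _+_ (ℕ.*-identityˡ (f q)) (∑-δ-∉ xs f (All.All¬⇒¬Any x∉xs))) (ℕ.+-identityʳ (f q))
  ... | no q≢x   = ∑-δ f unique λ q∉xs → fq≡0 λ { (here q≡x) → q≢x q≡x ; (there q∈xs) → q∉xs q∈xs }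

-- Subgraphs with prescribed degrees

-- `does (u ≟V w)` computes to `u ≟v w`, so lemmas about `_≟V_` apply to the tests in Defs.
_≟V_ : DecidableEquality Vertex
(i , j) ≟V (k , l) = map′ (λ (i≡k , j≡l) → cong₂ _,_ i≡k j≡l) ,-injective ((i ℕ.≟ k) ×-dec (j ℕ.≟ l))

≟v-reflects : ∀ u w → Reflects (u ≡ w) (u ≟v w)
≟v-reflects u w = proof (u ≟V w)

≟v-refl : ∀ u → (u ≟v u) ≡ true
≟v-refl u = dec-true (u ≟V u) refl

≟v-≢ : ∀ {u w} → u ≢ w → (u ≟v w) ≡ false
≟v-≢ {u} {w} = dec-false (u ≟V w)

≟v-comm : ∀ u w → (u ≟v w) ≡ (w ≟v u)
≟v-comm u w = does-⇔ (mk⇔ sym sym) (u ≟V w) (w ≟V u)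

-- Degree prescriptions ("demands") are integer valued so that they can be lowered freely;
-- a negative demand can never be met.
Demand : Set
Demand = Vertex → ℤ

infixl 6 _∖_ _↓_ _↑_

_∖_ : Demand → Edge → Demand
(t ∖ e) v = t v - + toℕ (incident v e)

_↓_ : Demand → Vertex → Demand
(t ↓ u) v = t v - + toℕ (v ≟v u)

_↑_ : Demand → Vertex → Demand
(t ↑ u) v = t v ℤ.+ + toℕ (v ≟v u)

nearPerfect : Vertex → Demand
nearPerfect h = (λ _ → + 1) ↓ h

-‿swap : ∀ a b c → a - b - c ≡ a - c - b
-‿swap = ℤ-solve-∀

∖-comm : ∀ t e e′ v → (t ∖ e ∖ e′) v ≡ (t ∖ e′ ∖ e) v
∖-comm t e e′ v = -‿swap (t v) _ _

↓-comm : ∀ t u w v → (t ↓ u ↓ w) v ≡ (t ↓ w ↓ u) v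
↓-comm t u w v = -‿swap (t v) _ _

↑-↓-cancel : ∀ t u v → (t ↑ u ↓ u) v ≡ t v
↑-↓-cancel t u v = cancel (t v) _
  where
  cancel : ∀ a b → a ℤ.+ b - b ≡ a
  cancel = ℤ-solve-∀

∖-≡-↓↓ : ∀ t {u w} → u ≢ w → ∀ v → (t ∖ (u , w)) v ≡ (t ↓ u ↓ w) v
∖-≡-↓↓ t {u} {w} u≢w v with v ≟v u | ≟v-reflects v u | v ≟v w | ≟v-reflects v w
... | true  | ofʸ refl | true  | ofʸ refl = contradiction refl u≢w
... | true  | _        | false | _        = sym (ℤ.+-identityʳ _)
... | false | _        | true  | _        = cong (_- + 1) (sym (ℤ.+-identityʳ (t v)))
... | false | _        | false | _        = sym (ℤ.+-identityʳ _)

allB-cong : ∀ {A : Set} {p q : A → Bool} → (∀ x → p x ≡ q x) → ∀ xs → allB p xs ≡ allB q xs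
allB-cong p≗q []       = refl
allB-cong p≗q (x ∷ xs) = cong₂ _∧_ (p≗q x) (allB-cong p≗q xs)

allB-false : ∀ {A : Set} {p : A → Bool} {x xs} → x ∈ xs → p x ≡ false → allB p xs ≡ false
allB-false {p = p} {xs = y ∷ ys} (here refl) px≡false rewrite px≡false = refl
allB-false {p = p} {xs = y ∷ ys} (there x∈ys) px≡false
  rewrite allB-false {p = p} x∈ys px≡false = ∧-zeroʳ (p y)

length-filterᵇ : ∀ {A : Set} (p : A → Bool) xs → length (filterᵇ p xs) ≡ ∑[ x ∈ xs ] toℕ (p x)
length-filterᵇ p []       = refl
length-filterᵇ p (x ∷ xs) with p x
... | true  = cong suc (length-filterᵇ p xs)
... | false = length-filterᵇ p xs

degIn-∷ : ∀ e M v → degIn (e ∷ M) v ≡ toℕ (incident v e) + degIn M v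
degIn-∷ e M v with incident v e
... | true  = refl
... | false = refl

+-≡-⇔ : ∀ a b c → (a ℤ.+ b ≡ c) ⇔ (b ≡ c - a)
+-≡-⇔ a b c = mk⇔ (λ { refl → sym (cancelˡ a b) }) (λ { refl → restore a c })
  where
  cancelˡ : ∀ a b → a ℤ.+ b - a ≡ b
  cancelˡ = ℤ-solve-∀
  restore : ∀ a c → a ℤ.+ (c - a) ≡ c
  restore = ℤ-solve-∀

∖-at : ∀ t e s {z b} → t s ≡ z → incident s e ≡ b → (t ∖ e) s ≡ z - + toℕ b
∖-at t e s ts≡z s∈e≡b = cong₂ (λ z b → z - + toℕ b) ts≡z s∈e≡b

module Factors (V : List Vertex) where

  isFactor : Demand → List Edge → Bool
  isFactor t M = allB (λ v → does (+ degIn M v ℤ.≟ t v)) V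

  #factors : List Edge → Demand → ℕ
  #factors E t = ∑[ M ∈ subsets E ] toℕ (isFactor t M)

  isFactor-∷ : ∀ t e M → isFactor t (e ∷ M) ≡ isFactor (t ∖ e) M
  isFactor-∷ t e M = allB-cong at V
    where
    at : ∀ v → does (+ degIn (e ∷ M) v ℤ.≟ t v) ≡ does (+ degIn M v ℤ.≟ (t ∖ e) v)
    at v = trans (cong (λ d → does (+ d ℤ.≟ t v)) (degIn-∷ e M v))
                 (does-⇔ (+-≡-⇔ (+ toℕ (incident v e)) (+ degIn M v) (t v)) (_ ℤ.≟ t v) (_ ℤ.≟ (t ∖ e) v))

  #factors-∷ : ∀ e E t → #factors (e ∷ E) t ≡ #factors E t + #factors E (t ∖ e)
  #factors-∷ e E t = begin
    #factors (e ∷ E) t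
      ≡⟨ ∑-++ (subsets E) (map (e ∷_) (subsets E)) _ ⟩
    #factors E t + (∑[ M ∈ map (e ∷_) (subsets E) ] toℕ (isFactor t M))
      ≡⟨ cong (#factors E t ℕ.+_) (∑-map (e ∷_) (subsets E) _) ⟩
    #factors E t + (∑[ M ∈ subsets E ] toℕ (isFactor t (e ∷ M)))
      ≡⟨ cong (#factors E t ℕ.+_) (∑-cong (subsets E) (λ M → cong toℕ (isFactor-∷ t e M))) ⟩
    #factors E t + #factors E (t ∖ e) ∎
    where open ≡-Reasoning

  #factors-cong : ∀ E {t t′} → (∀ v → t v ≡ t′ v) → #factors E t ≡ #factors E t′
  #factors-cong E t≗t′ =
    ∑-cong (subsets E) λ M → cong toℕ (allB-cong (λ v → cong (λ z → does (+ degIn M v ℤ.≟ z)) (t≗t′ v)) V)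

  #factors-negative : ∀ E t {v} → v ∈ V → t v ℤ.< + 0 → #factors E t ≡ 0
  #factors-negative []      t {v} v∈V tv<0 =
    cong (λ b → toℕ b + 0) (allB-false v∈V (dec-false (+ 0 ℤ.≟ t v) λ 0≡tv → ℤ.<-irrefl (sym 0≡tv) tv<0))
  #factors-negative (e ∷ E) t {v} v∈V tv<0 = trans (#factors-∷ e E t) (cong₂ _+_
    (#factors-negative E t v∈V tv<0)
    (#factors-negative E (t ∖ e) v∈V (ℤ.≤-<-trans (ℤ.i-j≤i (t v) _) tv<0)))

  expansionAt : List Edge → Demand → Vertex → ℕ
  expansionAt E t s = ∑[ e ∈ E ] toℕ (incident s e) * #factors E (t ∖ e)

  expansionAt-∷ : ∀ e E t s → expansionAt (e ∷ E) t s ≡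
    toℕ (incident s e) * #factors (e ∷ E) (t ∖ e) + (expansionAt E t s + expansionAt E (t ∖ e) s)
  expansionAt-∷ e E t s = cong (toℕ (incident s e) * #factors (e ∷ E) (t ∖ e) ℕ.+_)
    (trans (∑-cong E split) (∑-+ E _ _))
    where
    split : ∀ e′ → toℕ (incident s e′) * #factors (e ∷ E) (t ∖ e′) ≡
      toℕ (incident s e′) * #factors E (t ∖ e′) + toℕ (incident s e′) * #factors E (t ∖ e ∖ e′)
    split e′ = trans
      (cong (toℕ (incident s e′) ℕ.*_) (trans (#factors-∷ e E (t ∖ e′))
        (cong (#factors E (t ∖ e′) ℕ.+_) (#factors-cong E (∖-comm t e′ e)))))
      (ℕ.*-distribˡ-+ (toℕ (incident s e′)) _ _)

  expansionAt-≡0 : ∀ E t {s} → s ∈ V → t s ≡ + 0 → expansionAt E t s ≡ 0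
  expansionAt-≡0 E t {s} s∈V ts≡0 = trans (∑-cong E term) (∑-zero E)
    where
    term : ∀ e → toℕ (incident s e) * #factors E (t ∖ e) ≡ 0
    term e with incident s e in s∈e
    ... | false = refl
    ... | true  = cong (_+ 0) (#factors-negative E (t ∖ e) s∈V
                    (subst (ℤ._< + 0) (sym (∖-at t e s ts≡0 s∈e)) -<+))

  #factors-expand : ∀ E t {s} → s ∈ V → t s ≡ + 1 → #factors E t ≡ expansionAt E t s
  #factors-expand []      t s∈V ts≡1 =
    cong (λ b → toℕ b + 0) (allB-false s∈V (dec-false (+ 0 ℤ.≟ t _) λ 0≡ts → 0≢1 (trans 0≡ts ts≡1)))
    where
    0≢1 : + 0 ≢ + 1
    0≢1 ()
  #factors-expand (e ∷ E) t {s} s∈V ts≡1 = begin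
    #factors (e ∷ E) t
      ≡⟨ #factors-∷ e E t ⟩
    #factors E t + #factors E (t ∖ e)
      ≡⟨ by-incidence (incident s e) refl ⟩
    toℕ (incident s e) * #factors (e ∷ E) (t ∖ e) + (expansionAt E t s + expansionAt E (t ∖ e) s)
      ≡⟨ expansionAt-∷ e E t s ⟨
    expansionAt (e ∷ E) t s ∎
    where
    open ≡-Reasoning
    by-incidence : ∀ b → incident s e ≡ b → #factors E t + #factors E (t ∖ e) ≡
      toℕ b * #factors (e ∷ E) (t ∖ e) + (expansionAt E t s + expansionAt E (t ∖ e) s)
    by-incidence false s∉e = cong₂ _+_ (#factors-expand E t s∈V ts≡1)
                                          (#factors-expand E (t ∖ e) s∈V (∖-at t e s ts≡1 s∉e))
    by-incidence true  s∈e = begin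
      #factors E t + #factors E (t ∖ e)
        ≡⟨ cong (ℕ._+ #factors E (t ∖ e)) (#factors-expand E t s∈V ts≡1) ⟩
      expansionAt E t s + #factors E (t ∖ e)
        ≡⟨ shuffle (expansionAt E t s) (#factors E (t ∖ e)) ⟩
      1 * (#factors E (t ∖ e) + 0) + (expansionAt E t s + 0)
        ≡⟨ cong₂ (λ x y → 1 * (#factors E (t ∖ e) + x) + (expansionAt E t s + y)) overdrawn overdrawn-expansion ⟨
      1 * (#factors E (t ∖ e) + #factors E (t ∖ e ∖ e)) + (expansionAt E t s + expansionAt E (t ∖ e) s)
        ≡⟨ cong (λ x → 1 * x + (expansionAt E t s + expansionAt E (t ∖ e) s)) (#factors-∷ e E (t ∖ e)) ⟨
      1 * #factors (e ∷ E) (t ∖ e) + (expansionAt E t s + expansionAt E (t ∖ e) s) ∎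
      where
      ts∖e≡0 : (t ∖ e) s ≡ + 0
      ts∖e≡0 = ∖-at t e s ts≡1 s∈e
      overdrawn : #factors E (t ∖ e ∖ e) ≡ 0
      overdrawn = #factors-negative E (t ∖ e ∖ e) s∈V (subst (ℤ._< + 0) (sym (∖-at (t ∖ e) e s ts∖e≡0 s∈e)) -<+)
      overdrawn-expansion : expansionAt E (t ∖ e) s ≡ 0
      overdrawn-expansion = expansionAt-≡0 E (t ∖ e) s∈V ts∖e≡0
      shuffle : ∀ a b → a + b ≡ 1 * (b + 0) + (a + 0)
      shuffle = solve-∀

-- A parity criterion

ProperEdge : List Vertex → Edge → Set
ProperEdge V (u , w) = u ∈ V × w ∈ V × u ≢ w

adj : List Edge → (Vertex → ℕ) → Vertex → ℕ
adj E f v = ∑[ e ∈ E ] (toℕ (v ≟v proj₁ e) * f (proj₂ e) + toℕ (v ≟v proj₂ e) * f (proj₁ e))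

adj-cong : ∀ E {f g} → (∀ u → f u ≡ g u) → ∀ v → adj E f v ≡ adj E g v
adj-cong E f≗g v = ∑-cong E λ (u , w) → cong₂ (λ x y → toℕ (v ≟v u) * x + toℕ (v ≟v w) * y) (f≗g w) (f≗g u)

module SimpleGraph (V : List Vertex) (V-unique : Unique V) (E : List Edge) (E-proper : All (ProperEdge V) E) where

  open Factors V

  ∑-δV : ∀ {u} → u ∈ V → (f : Vertex → ℕ) → ∑[ v ∈ V ] toℕ (v ≟v u) * f v ≡ f u
  ∑-δV {u} u∈V f = trans (∑-cong V λ v → cong (λ b → toℕ b * f v) (≟v-comm v u))
                        (∑-δ _≟V_ f V-unique λ u∉V → contradiction u∈V u∉V)

  pairing : (Vertex → ℕ) → (Vertex → ℕ) → ℕ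
  pairing f g = ∑[ e ∈ E ] (f (proj₁ e) * g (proj₂ e) + f (proj₂ e) * g (proj₁ e))

  ∑-*-adj : ∀ f g → ∑[ v ∈ V ] f v * adj E g v ≡ pairing f g
  ∑-*-adj f g = begin
    ∑[ v ∈ V ] f v * adj E g v            ≡⟨ ∑-cong V (λ v → ∑-*ˡ (f v) E _) ⟨
    ∑[ v ∈ V ] ∑[ e ∈ E ] f v * term v e  ≡⟨ ∑-comm V E _ ⟩
    ∑[ e ∈ E ] ∑[ v ∈ V ] f v * term v e  ≡⟨ ∑-congᴬ (All.map at-edge E-proper) ⟩
    pairing f g                           ∎
    where
    open ≡-Reasoning
    term : Vertex → Edge → ℕ
    term v (u , w) = toℕ (v ≟v u) * g w + toℕ (v ≟v w) * g u
    at-edge : ∀ {e} → ProperEdge V e →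
              ∑[ v ∈ V ] f v * term v e ≡ f (proj₁ e) * g (proj₂ e) + f (proj₂ e) * g (proj₁ e)
    at-edge {u , w} (u∈V , w∈V , _) = begin
      ∑[ v ∈ V ] f v * term v (u , w)
        ≡⟨ ∑-cong V (λ v → distribute (f v) (toℕ (v ≟v u)) (g w) (toℕ (v ≟v w)) (g u)) ⟩
      ∑[ v ∈ V ] (g w * (toℕ (v ≟v u) * f v) + g u * (toℕ (v ≟v w) * f v))
        ≡⟨ ∑-+ V _ _ ⟩
      (∑[ v ∈ V ] g w * (toℕ (v ≟v u) * f v)) + (∑[ v ∈ V ] g u * (toℕ (v ≟v w) * f v))
        ≡⟨ cong₂ _+_ (∑-*ˡ (g w) V _) (∑-*ˡ (g u) V _) ⟩
      g w * (∑[ v ∈ V ] toℕ (v ≟v u) * f v) + g u * (∑[ v ∈ V ] toℕ (v ≟v w) * f v)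
        ≡⟨ cong₂ (λ x y → g w * x + g u * y) (∑-δV u∈V f) (∑-δV w∈V f) ⟩
      g w * f u + g u * f w
        ≡⟨ cong₂ _+_ (ℕ.*-comm (g w) (f u)) (ℕ.*-comm (g u) (f w)) ⟩
      f u * g w + f w * g u ∎
      where
      distribute : ∀ a i b j c → a * (i * b + j * c) ≡ b * (i * a) + c * (j * a)
      distribute = solve-∀

  adj-selfAdjoint : ∀ f g → ∑[ v ∈ V ] f v * adj E g v ≡ ∑[ v ∈ V ] g v * adj E f v
  adj-selfAdjoint f g =
    trans (∑-*-adj f g) (trans (∑-cong E λ (u , w) → swap (f u) (g w) (f w) (g u)) (sym (∑-*-adj g f)))
    where
    swap : ∀ a b c d → a * b + c * d ≡ d * c + b * a
    swap = solve-∀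

  adj-#factors-↓ : ∀ t s → adj E (λ u → #factors E (t ↓ s ↓ u)) s ≡ expansionAt E t s
  adj-#factors-↓ t s = ∑-congᴬ (All.map at-edge E-proper)
    where
    at-edge : ∀ {e} → ProperEdge V e →
      toℕ (s ≟v proj₁ e) * #factors E (t ↓ s ↓ proj₂ e) + toℕ (s ≟v proj₂ e) * #factors E (t ↓ s ↓ proj₁ e)
        ≡ toℕ ((s ≟v proj₁ e) ∨ (s ≟v proj₂ e)) * #factors E (t ∖ e)
    at-edge {u , w} (_ , _ , u≢w) with s ≟v u | ≟v-reflects s u | s ≟v w | ≟v-reflects s w
    ... | true  | ofʸ refl | true  | ofʸ refl = contradiction refl u≢w
    ... | true  | ofʸ refl | false | _        =
      trans (ℕ.+-identityʳ _) (cong (1 *_) (#factors-cong E λ v → sym (∖-≡-↓↓ t u≢w v)))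
    ... | false | _        | true  | ofʸ refl =
      cong (1 *_) (#factors-cong E λ v → trans (↓-comm t w u v) (sym (∖-≡-↓↓ t u≢w v)))
    ... | false | _        | false | _        = refl

  expansionAt-even : ∀ t {s} → s ∈ V → t s ≡ + 2 → (∀ o → o ≢ s → t o ℤ.≤ + 1) → 2 ∣ expansionAt E t s
  expansionAt-even t {s} s∈V ts≡2 t≤1 =
    subst (2 ∣_) (sym as-double-sum) (∑-sym-even E pair pair-sym (All.map diagonal E-proper))
    where
    pair : Edge → Edge → ℕ
    pair e e′ = toℕ (incident s e) * (toℕ (incident s e′) * #factors E (t ∖ e ∖ e′))

    expand-at : ∀ e → toℕ (incident s e) * #factors E (t ∖ e) ≡ toℕ (incident s e) * expansionAt E (t ∖ e) s
    expand-at e with incident s e in s∈e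
    ... | false = refl
    ... | true  = cong (1 *_) (#factors-expand E (t ∖ e) s∈V (∖-at t e s ts≡2 s∈e))

    as-double-sum : expansionAt E t s ≡ ∑[ e ∈ E ] ∑[ e′ ∈ E ] pair e e′
    as-double-sum = ∑-cong E λ e → trans (expand-at e) (sym (∑-*ˡ (toℕ (incident s e)) E _))

    pair-sym : ∀ e e′ → pair e e′ ≡ pair e′ e
    pair-sym e e′ = trans (swap (toℕ (incident s e)) (toℕ (incident s e′)) _)
                          (cong (λ n → toℕ (incident s e′) * (toℕ (incident s e) * n)) (#factors-cong E (∖-comm t e e′)))
      where
      swap : ∀ a b n → a * (b * n) ≡ b * (a * n)
      swap = solve-∀

    twice-lowered : ∀ z → z ℤ.≤ + 1 → z - + 1 - + 1 ℤ.< + 0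
    twice-lowered (+ 0)          _               = -<+
    twice-lowered (+ 1)          _               = -<+
    twice-lowered (+ ℕ.suc (ℕ.suc _)) (+≤+ (s≤s ()))
    twice-lowered ℤ.-[1+ _ ]     _               = -<+

    -- Removing the same edge twice overdraws an endpoint other than s, whose demand is at most 1.
    diagonal : ∀ {e} → ProperEdge V e → 2 ∣ pair e e
    diagonal {e@(u , w)} (u∈V , w∈V , u≢w) =
      ∣n⇒∣m*n (toℕ (incident s e)) (∣n⇒∣m*n (toℕ (incident s e)) (subst (2 ∣_) (sym overdrawn) (2 ∣0)))
      where
      overdrawn-at : ∀ {o} → o ∈ V → o ≢ s → incident o e ≡ true → #factors E (t ∖ e ∖ e) ≡ 0
      overdrawn-at {o} o∈V o≢s o∈e = #factors-negative E (t ∖ e ∖ e) o∈V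
        (subst (ℤ._< + 0) (sym (∖-at (t ∖ e) e o (∖-at t e o refl o∈e) o∈e)) (twice-lowered (t o) (t≤1 o o≢s)))
      overdrawn : #factors E (t ∖ e ∖ e) ≡ 0
      overdrawn with u ≟v s | ≟v-reflects u s
      ... | true  | ofʸ refl = overdrawn-at w∈V (u≢w ∘ sym) (trans (cong ((w ≟v u) ∨_) (≟v-refl w)) (∨-zeroʳ _))
      ... | false | ofⁿ u≢s  = overdrawn-at u∈V u≢s (cong (_∨ (u ≟v w)) (≟v-refl u))

  -- Raising the demand at s to 2 turns the terms of this sum into the expansion at s.
  adj-#factors-↓-even : ∀ t {s} → s ∈ V → t s ≡ + 1 → (∀ o → o ≢ s → t o ℤ.≤ + 1) →
                        2 ∣ adj E (λ u → #factors E (t ↓ u)) s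
  adj-#factors-↓-even t {s} s∈V ts≡1 t≤1 = subst (2 ∣_) as-expansion (expansionAt-even (t ↑ s) s∈V raised bounded)
    where
    as-expansion : expansionAt E (t ↑ s) s ≡ adj E (λ u → #factors E (t ↓ u)) s
    as-expansion = trans (sym (adj-#factors-↓ (t ↑ s) s))
      (adj-cong E (λ u → #factors-cong E λ w → cong (_- + toℕ (w ≟v u)) (↑-↓-cancel t s w)) s)
    raised : t s ℤ.+ + toℕ (s ≟v s) ≡ + 2
    raised = cong₂ (λ z b → z ℤ.+ + toℕ b) ts≡1 (≟v-refl s)
    bounded : ∀ o → o ≢ s → t o ℤ.+ + toℕ (o ≟v s) ℤ.≤ + 1
    bounded o o≢s = subst (λ b → t o ℤ.+ + toℕ b ℤ.≤ + 1) (sym (≟v-≢ o≢s))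
                          (subst (ℤ._≤ + 1) (sym (ℤ.+-identityʳ (t o))) (t≤1 o o≢s))

  nearPerfect-even : ∀ (x : Vertex → Bool) {h s₀} → (∀ {v} → v ∈ V → 2 ∣ adj E (toℕ ∘ x) v) →
                     x h ≡ false → s₀ ∈ V → x s₀ ≡ true → 2 ∣ #factors E (nearPerfect h)
  nearPerfect-even x {h} {s₀} x-even xh≡false s₀∈V xs₀≡true =
    subst (2 ∣_) at-s₀ (∣m+n∣m⇒∣n (subst (2 ∣_) split total) (∑-even (All.tabulate elsewhere)))
    where
    t₀ : Demand
    t₀ = nearPerfect h ↓ s₀

    P : Vertex → ℕ
    P u = #factors E (t₀ ↓ u)

    marked≢h : ∀ {v} → x v ≡ true → v ≢ h
    marked≢h xv≡true refl with () ← trans (sym xv≡true) xh≡false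

    total : 2 ∣ ∑[ v ∈ V ] toℕ (x v) * adj E P v
    total = subst (2 ∣_) (adj-selfAdjoint P (toℕ ∘ x)) (∑-even (All.tabulate λ {v} v∈V → ∣n⇒∣m*n (P v) (x-even v∈V)))

    others : Vertex → Bool
    others v = x v ∧ not (v ≟v s₀)

    indicator-split : ∀ v → toℕ (x v) ≡ toℕ (others v) + toℕ (v ≟v s₀)
    indicator-split v with v ≟v s₀ | ≟v-reflects v s₀
    ... | true  | ofʸ refl rewrite xs₀≡true = refl
    ... | false | _        = trans (cong toℕ (sym (∧-identityʳ (x v)))) (sym (ℕ.+-identityʳ _))

    split : ∑[ v ∈ V ] toℕ (x v) * adj E P v ≡ (∑[ v ∈ V ] toℕ (others v) * adj E P v) + adj E P s₀
    split = begin
      ∑[ v ∈ V ] toℕ (x v) * adj E P v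
        ≡⟨ ∑-cong V (λ v → trans (cong (_* adj E P v) (indicator-split v)) (ℕ.*-distribʳ-+ (adj E P v) (toℕ (others v)) (toℕ (v ≟v s₀)))) ⟩
      ∑[ v ∈ V ] (toℕ (others v) * adj E P v + toℕ (v ≟v s₀) * adj E P v)
        ≡⟨ ∑-+ V _ _ ⟩
      (∑[ v ∈ V ] toℕ (others v) * adj E P v) + (∑[ v ∈ V ] toℕ (v ≟v s₀) * adj E P v)
        ≡⟨ cong ((∑[ v ∈ V ] toℕ (others v) * adj E P v) ℕ.+_) (∑-δV s₀∈V (adj E P)) ⟩
      (∑[ v ∈ V ] toℕ (others v) * adj E P v) + adj E P s₀ ∎
      where open ≡-Reasoning

    at-s₀ : adj E P s₀ ≡ #factors E (nearPerfect h)
    at-s₀ = trans (adj-#factors-↓ (nearPerfect h) s₀) (sym (#factors-expand E (nearPerfect h) s₀∈V unmatched))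
      where
      unmatched : + 1 - + toℕ (s₀ ≟v h) ≡ + 1
      unmatched = cong (λ b → + 1 - + toℕ b) (≟v-≢ (marked≢h xs₀≡true))

    at-marked : ∀ {v} → v ∈ V → x v ≡ true → v ≢ s₀ → 2 ∣ adj E P v
    at-marked {v} v∈V xv≡true v≢s₀ = adj-#factors-↓-even t₀ v∈V demand-one (λ o _ → at-most-one (o ≟v h) (o ≟v s₀))
      where
      demand-one : + 1 - + toℕ (v ≟v h) - + toℕ (v ≟v s₀) ≡ + 1
      demand-one rewrite ≟v-≢ (marked≢h xv≡true) | ≟v-≢ v≢s₀ = refl
      at-most-one : ∀ b₁ b₂ → + 1 - + toℕ b₁ - + toℕ b₂ ℤ.≤ + 1
      at-most-one false false = +≤+ (s≤s z≤n)
      at-most-one false true  = +≤+ z≤n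
      at-most-one true  false = +≤+ z≤n
      at-most-one true  true  = -≤+

    elsewhere : ∀ {v} → v ∈ V → 2 ∣ toℕ (others v) * adj E P v
    elsewhere {v} v∈V with x v in xv≡ | v ≟v s₀ | ≟v-reflects v s₀
    ... | false | _    | _         = 2 ∣0
    ... | true  | true | _         = 2 ∣0
    ... | true  | false | ofⁿ v≢s₀ = ∣n⇒∣m*n 1 (at-marked v∈V xv≡ v≢s₀)

-- The grid

range1-unique : ∀ n → Unique (range1 n)
range1-unique n = Unique.map⁺ ℕ.suc-injective (Unique.upTo⁺ n)

∈-range1⁺ : ∀ {i n} → 1 ≤ i → i ≤ n → i ∈ range1 n
∈-range1⁺ {suc k} (s≤s z≤n) k<n = ∈-map⁺ suc (∈-upTo⁺ k<n)

∈-range1⁻ : ∀ {i n} → i ∈ range1 n → 1 ≤ i × i ≤ n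
∈-range1⁻ i∈ with k , k∈ , refl ← ∈-map⁻ suc i∈ = s≤s z≤n , ∈-upTo⁻ k∈

∉-range1⇒≡0 : ∀ {i n} → i ≤ n → i ∉ range1 n → i ≡ 0
∉-range1⇒≡0 {zero}  _   _   = refl
∉-range1⇒≡0 {suc i} i≤n i∉ = contradiction (∈-range1⁺ (s≤s z≤n) i≤n) i∉

∉-range1-pred⇒≡ : ∀ {i n} → i ∈ range1 n → i ∉ range1 (n ∸ 1) → i ≡ n
∉-range1-pred⇒≡ {i} {n} i∈ i∉ with ∈-range1⁻ i∈
... | 1≤i , i≤n with ℕ.m≤n⇒m<n∨m≡n i≤n
...   | inj₁ (s≤s i≤n-1) = contradiction (∈-range1⁺ 1≤i i≤n-1) i∉
...   | inj₂ i≡n         = i≡n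

range1-pred⇒range1 : ∀ {j n} → j ∈ range1 (n ∸ 1) → j ∈ range1 n × suc j ∈ range1 n
range1-pred⇒range1 {j} {suc n} j∈ with ∈-range1⁻ j∈
... | 1≤j , j≤n = ∈-range1⁺ 1≤j (ℕ.m≤n⇒m≤1+n j≤n) , ∈-range1⁺ (s≤s z≤n) (s≤s j≤n)

vertices-cartesianProduct : ∀ r c → vertices r c ≡ cartesianProduct (range1 r) (range1 c)
vertices-cartesianProduct r c = go (range1 r)
  where
  go : ∀ is → concatMap (λ i → map (i ,_) (range1 c)) is ≡ cartesianProduct is (range1 c)
  go []       = refl
  go (i ∷ is) = cong (map (i ,_) (range1 c) ++_) (go is)

vertices-unique : ∀ r c → Unique (vertices r c)
vertices-unique r c = subst Unique (sym (vertices-cartesianProduct r c))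
  (Unique.cartesianProduct⁺ (range1-unique r) (range1-unique c))

∈-vertices⁺ : ∀ {r c i j} → i ∈ range1 r → j ∈ range1 c → (i , j) ∈ vertices r c
∈-vertices⁺ {r} {c} i∈ j∈ = subst ((_ , _) ∈_) (sym (vertices-cartesianProduct r c))
  (Any.map (λ { (refl , refl) → refl }) (Any.cartesianProduct⁺ i∈ j∈))

∈-vertices⁻ : ∀ {r c i j} → (i , j) ∈ vertices r c → i ∈ range1 r × j ∈ range1 c
∈-vertices⁻ {r} {c} ij∈ = Any.cartesianProduct⁻ (range1 r) (range1 c)
  (Any.map ,-injective (subst ((_ , _) ∈_) (vertices-cartesianProduct r c) ij∈))

right down : Vertex → Vertex
right (i , j) = i , suc j
down  (i , j) = suc i , j

edgesAlong : (Vertex → Vertex) → List Vertex → List Edge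
edgesAlong σ = map (λ u → u , σ u)

horizontal-edgesAlong : ∀ r c → horizontal r c ≡ edgesAlong right (vertices r (c ∸ 1))
horizontal-edgesAlong r c = sym (trans (map-concatMap _ _ (range1 r))
  (concatMap-cong (λ i → sym (map-∘ (range1 (c ∸ 1)))) (range1 r)))

vertical-edgesAlong : ∀ r c → vertical r c ≡ edgesAlong down (vertices (r ∸ 1) c)
vertical-edgesAlong r c = sym (trans (map-concatMap _ _ (range1 (r ∸ 1)))
  (concatMap-cong (λ i → sym (map-∘ (range1 c))) (range1 (r ∸ 1))))

gridEdges-proper : ∀ r c → All (ProperEdge (vertices r c)) (gridEdges r c)
gridEdges-proper r c = All.++⁺
  (subst (All _) (sym (horizontal-edgesAlong r c)) (All.map⁺ (All.tabulate horizontal-proper)))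
  (subst (All _) (sym (vertical-edgesAlong r c)) (All.map⁺ (All.tabulate vertical-proper)))
  where
  horizontal-proper : ∀ {u} → u ∈ vertices r (c ∸ 1) → ProperEdge (vertices r c) (u , right u)
  horizontal-proper u∈ with i∈ , j∈ ← ∈-vertices⁻ {r} u∈ with j∈′ , sj∈ ← range1-pred⇒range1 {n = c} j∈ =
    ∈-vertices⁺ i∈ j∈′ , ∈-vertices⁺ i∈ sj∈ , ℕ.1+n≢n ∘ sym ∘ proj₂ ∘ ,-injective
  vertical-proper : ∀ {u} → u ∈ vertices (r ∸ 1) c → ProperEdge (vertices r c) (u , down u)
  vertical-proper u∈ with i∈ , j∈ ← ∈-vertices⁻ {r ∸ 1} u∈ with i∈′ , si∈ ← range1-pred⇒range1 {n = r} i∈ =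
    ∈-vertices⁺ i∈′ j∈ , ∈-vertices⁺ si∈ j∈ , ℕ.1+n≢n ∘ sym ∘ proj₁ ∘ ,-injective

-- Along σ, v is joined to σ v and to the w with σ w = v, as far as these edges are listed in W.
adj-edgesAlong : ∀ σ {W} (X : Vertex → ℕ) {v w} → Unique W → (∀ u → (v ≟v σ u) ≡ (w ≟v u)) →
                 (v ∉ W → X (σ v) ≡ 0) → (w ∉ W → X w ≡ 0) → adj (edgesAlong σ W) X v ≡ X (σ v) + X w
adj-edgesAlong σ {W} X {v} {w} W-unique σ⁻¹ σv∉ w∉ = begin
  adj (edgesAlong σ W) X v
    ≡⟨ ∑-map _ W _ ⟩
  ∑[ u ∈ W ] (toℕ (v ≟v u) * X (σ u) + toℕ (v ≟v σ u) * X u)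
    ≡⟨ ∑-+ W _ _ ⟩
  (∑[ u ∈ W ] toℕ (v ≟v u) * X (σ u)) + (∑[ u ∈ W ] toℕ (v ≟v σ u) * X u)
    ≡⟨ cong ((∑[ u ∈ W ] toℕ (v ≟v u) * X (σ u)) ℕ.+_) (∑-cong W λ u → cong (λ b → toℕ b * X u) (σ⁻¹ u)) ⟩
  (∑[ u ∈ W ] toℕ (v ≟v u) * X (σ u)) + (∑[ u ∈ W ] toℕ (w ≟v u) * X u)
    ≡⟨ cong₂ _+_ (∑-δ _≟V_ (X ∘ σ) W-unique σv∉) (∑-δ _≟V_ X W-unique w∉) ⟩
  X (σ v) + X w ∎
  where open ≡-Reasoning

OnFrame : ℕ → ℕ → Set
OnFrame n i = i ≡ 0 ⊎ i ≡ suc n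

adj-grid : ∀ r c (X : Vertex → ℕ) → (∀ {i j} → OnFrame r i ⊎ OnFrame c j → X (i , j) ≡ 0) →
           ∀ {p q} → (suc p , suc q) ∈ vertices r c →
           adj (gridEdges r c) X (suc p , suc q) ≡
             (X (suc p , suc (suc q)) + X (suc p , q)) + (X (suc (suc p) , suc q) + X (p , suc q))
adj-grid r c X X-frame {p} {q} v∈ with p∈ , q∈ ← ∈-vertices⁻ {r} {c} v∈ =
  trans (∑-++ (horizontal r c) (vertical r c) _) (cong₂ _+_ along-rows along-columns)
  where
  v : Vertex
  v = (suc p , suc q)
  along-rows : adj (horizontal r c) X v ≡ X (suc p , suc (suc q)) + X (suc p , q)
  along-rows = trans (cong (λ E → adj E X v) (horizontal-edgesAlong r c))
    (adj-edgesAlong right X (vertices-unique r (c ∸ 1)) (λ _ → refl)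
      (λ v∉ → X-frame (inj₂ (inj₂ (cong suc (∉-range1-pred⇒≡ q∈ (v∉ ∘ ∈-vertices⁺ p∈))))))
      (λ w∉ → X-frame (inj₂ (inj₁ (∉-range1⇒≡0 (ℕ.∸-monoˡ-≤ 1 (proj₂ (∈-range1⁻ q∈)))
                                                (w∉ ∘ ∈-vertices⁺ p∈))))))
  along-columns : adj (vertical r c) X v ≡ X (suc (suc p) , suc q) + X (p , suc q)
  along-columns = trans (cong (λ E → adj E X v) (vertical-edgesAlong r c))
    (adj-edgesAlong down X (vertices-unique (r ∸ 1) c) (λ _ → refl)
      (λ v∉ → X-frame (inj₁ (inj₂ (cong suc (∉-range1-pred⇒≡ p∈ (v∉ ∘ flip ∈-vertices⁺ q∈))))))
      (λ w∉ → X-frame (inj₁ (inj₁ (∉-range1⇒≡0 (ℕ.∸-monoˡ-≤ 1 (proj₂ (∈-range1⁻ p∈)))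
                                                (w∉ ∘ flip ∈-vertices⁺ q∈))))))

-- A balanced marking of the grid

∣-respects-≡mod : ∀ {k u v} → k ∣ℤ u - v → (k ∣ℤ u ⇔ k ∣ℤ v)
∣-respects-≡mod {k} {u} {v} k∣u-v = mk⇔
  (λ k∣u → subst (k ∣ℤ_) (back u v) (ℤ.∣m∣n⇒∣m-n k∣u k∣u-v))
  (λ k∣v → subst (k ∣ℤ_) (forth u v) (ℤ.∣m∣n⇒∣m+n k∣u-v k∣v))
  where
  back : ∀ u v → u - (u - v) ≡ v
  back = ℤ-solve-∀
  forth : ∀ u v → u - v ℤ.+ v ≡ u
  forth = ℤ-solve-∀

∣-neg⇔ : ∀ {k u} → k ∣ℤ - u ⇔ k ∣ℤ u
∣-neg⇔ {k} {u} = mk⇔ (λ k∣-u → subst (k ∣ℤ_) (ℤ.neg-involutive u) (ℤ.∣m⇒∣-m k∣-u)) ℤ.∣m⇒∣-m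

¬∣-small : ∀ {m z} → 0 < ℤ.∣ z ∣ → ℤ.∣ z ∣ < m → ¬ (+ m ∣ℤ z)
¬∣-small 0<∣z∣ ∣z∣<m m∣z = ℕ.<⇒≱ ∣z∣<m (∣⇒≤ {{ℕ.>-nonZero 0<∣z∣}} (ℤ.∣⇒∣ᵤ m∣z))

xor-square-even : ∀ α β γ δ → 2 ∣ ((toℕ (α xor δ) + toℕ (β xor γ)) + (toℕ (α xor γ) + toℕ (β xor δ)))
xor-square-even true  true  true  true  = divides 0 refl
xor-square-even true  true  true  false = divides 1 refl
xor-square-even true  true  false true  = divides 1 refl
xor-square-even true  true  false false = divides 2 refl
xor-square-even true  false true  true  = divides 1 refl
xor-square-even true  false true  false = divides 1 refl
xor-square-even true  false false true  = divides 1 refl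
xor-square-even true  false false false = divides 1 refl
xor-square-even false true  true  true  = divides 1 refl
xor-square-even false true  true  false = divides 1 refl
xor-square-even false true  false true  = divides 1 refl
xor-square-even false true  false false = divides 1 refl
xor-square-even false false true  true  = divides 2 refl
xor-square-even false false true  false = divides 1 refl
xor-square-even false false false true  = divides 1 refl
xor-square-even false false false false = divides 0 refl

module Marking (N : ℕ) where

  ≡±1 : ℤ → Bool
  ≡±1 t = does (+ N ∣ℤ? t - + 1) ∨ does (+ N ∣ℤ? t ℤ.+ + 1)

  markℤ : ℤ → ℤ → Bool
  markℤ a b = ≡±1 (a ℤ.+ b) xor ≡±1 (a - b)

  mark : Vertex → Bool
  mark (i , j) = markℤ (+ i) (+ j)

  ≡±1-cong : ∀ u v → + N ∣ℤ u - v → ≡±1 u ≡ ≡±1 v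
  ≡±1-cong u v N∣u-v = cong₂ _∨_
    (does-⇔ (∣-respects-≡mod (subst (+ N ∣ℤ_) (shift u v (- + 1)) N∣u-v)) (+ N ∣ℤ? u - + 1) (+ N ∣ℤ? v - + 1))
    (does-⇔ (∣-respects-≡mod (subst (+ N ∣ℤ_) (shift u v (+ 1)) N∣u-v)) (+ N ∣ℤ? u ℤ.+ + 1) (+ N ∣ℤ? v ℤ.+ + 1))
    where
    shift : ∀ u v s → u - v ≡ (u ℤ.+ s) - (v ℤ.+ s)
    shift = ℤ-solve-∀

  ≡±1-neg : ∀ u → ≡±1 (- u) ≡ ≡±1 u
  ≡±1-neg u = trans
    (cong₂ _∨_ (does-⇔ (subst (λ z → + N ∣ℤ z ⇔ + N ∣ℤ u ℤ.+ + 1) (neg₁ u) ∣-neg⇔) (+ N ∣ℤ? - u - + 1) (+ N ∣ℤ? _))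
               (does-⇔ (subst (λ z → + N ∣ℤ z ⇔ + N ∣ℤ u - + 1) (neg₂ u) ∣-neg⇔) (+ N ∣ℤ? - u ℤ.+ + 1) (+ N ∣ℤ? _)))
    (∨-comm (does (+ N ∣ℤ? u ℤ.+ + 1)) (does (+ N ∣ℤ? u - + 1)))
    where
    neg₁ : ∀ u → - (u ℤ.+ + 1) ≡ - u - + 1
    neg₁ = ℤ-solve-∀
    neg₂ : ∀ u → - (u - + 1) ≡ - u ℤ.+ + 1
    neg₂ = ℤ-solve-∀

  markℤ-row : ∀ a b → + N ∣ℤ a ℤ.+ a → markℤ a b ≡ false
  markℤ-row a b N∣2a = trans (cong (_xor ≡±1 (a - b)) (trans sum≡-diff (≡±1-neg (a - b)))) (xor-same (≡±1 (a - b)))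
    where
    reflect : ∀ a b → a ℤ.+ a ≡ (a ℤ.+ b) - - (a - b)
    reflect = ℤ-solve-∀
    sum≡-diff : ≡±1 (a ℤ.+ b) ≡ ≡±1 (- (a - b))
    sum≡-diff = ≡±1-cong (a ℤ.+ b) (- (a - b)) (subst (+ N ∣ℤ_) (reflect a b) N∣2a)

  markℤ-column : ∀ a b → + N ∣ℤ b ℤ.+ b → markℤ a b ≡ false
  markℤ-column a b N∣2b = trans (cong (_xor ≡±1 (a - b)) sum≡diff) (xor-same (≡±1 (a - b)))
    where
    reflect : ∀ a b → b ℤ.+ b ≡ (a ℤ.+ b) - (a - b)
    reflect = ℤ-solve-∀
    sum≡diff : ≡±1 (a ℤ.+ b) ≡ ≡±1 (a - b)
    sum≡diff = ≡±1-cong (a ℤ.+ b) (a - b) (subst (+ N ∣ℤ_) (reflect a b) N∣2b)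

  markℤ-balanced : ∀ a b → 2 ∣ ((toℕ (markℤ a (+ 1 ℤ.+ b)) + toℕ (markℤ a (b - + 1)))
                                  + (toℕ (markℤ (+ 1 ℤ.+ a) b) + toℕ (markℤ (a - + 1) b)))
  markℤ-balanced a b = subst (2 ∣_) (sym corners)
    (xor-square-even (≡±1 (+ 1 ℤ.+ s)) (≡±1 (s - + 1)) (≡±1 (+ 1 ℤ.+ d)) (≡±1 (d - + 1)))
    where
    s d : ℤ
    s = a ℤ.+ b
    d = a - b
    at : ∀ a b {σ δ} → a ℤ.+ b ≡ σ → a - b ≡ δ → toℕ (markℤ a b) ≡ toℕ (≡±1 σ xor ≡±1 δ)
    at a b refl refl = refl
    e₁ : ∀ a b → a ℤ.+ (+ 1 ℤ.+ b) ≡ + 1 ℤ.+ (a ℤ.+ b)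
    e₁ = ℤ-solve-∀
    e₂ : ∀ a b → a - (+ 1 ℤ.+ b) ≡ (a - b) - + 1
    e₂ = ℤ-solve-∀
    e₃ : ∀ a b → a ℤ.+ (b - + 1) ≡ (a ℤ.+ b) - + 1
    e₃ = ℤ-solve-∀
    e₄ : ∀ a b → a - (b - + 1) ≡ + 1 ℤ.+ (a - b)
    e₄ = ℤ-solve-∀
    e₅ : ∀ a b → (+ 1 ℤ.+ a) ℤ.+ b ≡ + 1 ℤ.+ (a ℤ.+ b)
    e₅ = ℤ-solve-∀
    e₆ : ∀ a b → (+ 1 ℤ.+ a) - b ≡ + 1 ℤ.+ (a - b)
    e₆ = ℤ-solve-∀
    e₇ : ∀ a b → (a - + 1) ℤ.+ b ≡ (a ℤ.+ b) - + 1
    e₇ = ℤ-solve-∀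
    e₈ : ∀ a b → (a - + 1) - b ≡ (a - b) - + 1
    e₈ = ℤ-solve-∀
    corners : (toℕ (markℤ a (+ 1 ℤ.+ b)) + toℕ (markℤ a (b - + 1)))
              + (toℕ (markℤ (+ 1 ℤ.+ a) b) + toℕ (markℤ (a - + 1) b))
            ≡ (toℕ (≡±1 (+ 1 ℤ.+ s) xor ≡±1 (d - + 1)) + toℕ (≡±1 (s - + 1) xor ≡±1 (+ 1 ℤ.+ d)))
              + (toℕ (≡±1 (+ 1 ℤ.+ s) xor ≡±1 (+ 1 ℤ.+ d)) + toℕ (≡±1 (s - + 1) xor ≡±1 (d - + 1)))
    corners = cong₂ ℕ._+_ (cong₂ ℕ._+_ (at a (+ 1 ℤ.+ b) (e₁ a b) (e₂ a b)) (at a (b - + 1) (e₃ a b) (e₄ a b)))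
                          (cong₂ ℕ._+_ (at (+ 1 ℤ.+ a) b (e₅ a b) (e₆ a b)) (at (a - + 1) b (e₇ a b) (e₈ a b)))

  ≡±1-even : 2 ∣ N → ∀ t → + 2 ∣ℤ t → ≡±1 t ≡ false
  ≡±1-even 2∣N t 2∣t = cong₂ _∨_
    (dec-false (+ N ∣ℤ? t - + 1) λ N∣ → 2∤±1 refl (subst (+ 2 ∣ℤ_) (step₁ t) (ℤ.∣m∣n⇒∣m-n 2∣t (ℤ.∣-trans 2∣+N N∣))))
    (dec-false (+ N ∣ℤ? t ℤ.+ + 1) λ N∣ → 2∤±1 refl (subst (+ 2 ∣ℤ_) (step₂ t) (ℤ.∣m∣n⇒∣m-n 2∣t (ℤ.∣-trans 2∣+N N∣))))
    where
    2∣+N : + 2 ∣ℤ + N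
    2∣+N = ℤ.∣ᵤ⇒∣ 2∣N
    2∤±1 : ∀ {z} → ℤ.∣ z ∣ ≡ 1 → ¬ (+ 2 ∣ℤ z)
    2∤±1 ∣z∣≡1 = ¬∣-small (subst (0 <_) (sym ∣z∣≡1) (s≤s z≤n)) (subst (_< 2) (sym ∣z∣≡1) (s≤s (s≤s z≤n)))
    step₁ : ∀ t → t - (t - + 1) ≡ + 1
    step₁ = ℤ-solve-∀
    step₂ : ∀ t → t - (t ℤ.+ + 1) ≡ - + 1
    step₂ = ℤ-solve-∀

  markℤ-even : 2 ∣ N → ∀ a b → + 2 ∣ℤ a ℤ.+ b → markℤ a b ≡ false
  markℤ-even 2∣N a b 2∣a+b = cong₂ _xor_ (≡±1-even 2∣N (a ℤ.+ b) 2∣a+b) (≡±1-even 2∣N (a - b) 2∣a-b)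
    where
    difference : ∀ a b → a ℤ.+ b - + 2 ℤ.* b ≡ a - b
    difference = ℤ-solve-∀
    2∣a-b : + 2 ∣ℤ a - b
    2∣a-b = subst (+ 2 ∣ℤ_) (difference a b) (ℤ.∣m∣n⇒∣m-n 2∣a+b (ℤ.∣m⇒∣m*n b (ℤ.∣-refl {+ 2})))

  mark-1-2 : 4 < N → mark (1 , 2) ≡ true
  mark-1-2 4<N = cong₂ _xor_
    (cong₂ _∨_ (dec-false (+ N ∣ℤ? + 2) (¬∣-small (s≤s z≤n) (ℕ.<-trans (s≤s (s≤s (s≤s z≤n))) 4<N)))
               (dec-false (+ N ∣ℤ? + 4) (¬∣-small (s≤s z≤n) 4<N)))
    (cong₂ _∨_ (dec-false (+ N ∣ℤ? ℤ.-[1+ 1 ]) (¬∣-small (s≤s z≤n) (ℕ.<-trans (s≤s (s≤s (s≤s z≤n))) 4<N)))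
               (dec-true (+ N ∣ℤ? + 0) (ℤ.∣ᵤ⇒∣ (N ∣0))))

  mark-frame : ∀ {r c} → + N ∣ℤ + suc r ℤ.+ + suc r → + N ∣ℤ + suc c ℤ.+ + suc c →
               ∀ {i j} → OnFrame r i ⊎ OnFrame c j → toℕ (mark (i , j)) ≡ 0
  mark-frame         _        _        {j = j} (inj₁ (inj₁ refl)) = cong toℕ (markℤ-row (+ 0) (+ j) (ℤ.∣ᵤ⇒∣ (N ∣0)))
  mark-frame {r}     N∣2[1+r] _        {j = j} (inj₁ (inj₂ refl)) = cong toℕ (markℤ-row (+ suc r) (+ j) N∣2[1+r])
  mark-frame         _        _        {i = i} (inj₂ (inj₁ refl)) = cong toℕ (markℤ-column (+ i) (+ 0) (ℤ.∣ᵤ⇒∣ (N ∣0)))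
  mark-frame {c = c} _        N∣2[1+c] {i = i} (inj₂ (inj₂ refl)) = cong toℕ (markℤ-column (+ i) (+ suc c) N∣2[1+c])

  mark-balanced : ∀ {r c} → + N ∣ℤ + suc r ℤ.+ + suc r → + N ∣ℤ + suc c ℤ.+ + suc c →
                  ∀ {v} → v ∈ vertices r c → 2 ∣ adj (gridEdges r c) (toℕ ∘ mark) v
  mark-balanced {r} {c} _ _ {zero , _}     v∈ with () ← proj₁ (∈-range1⁻ (proj₁ (∈-vertices⁻ {r} {c} v∈)))
  mark-balanced {r} {c} _ _ {suc _ , zero} v∈ with () ← proj₁ (∈-range1⁻ (proj₂ (∈-vertices⁻ {r} {c} v∈)))
  mark-balanced {r} {c} N∣2[1+r] N∣2[1+c] {suc p , suc q} v∈ =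
    subst (2 ∣_) (sym (adj-grid r c (toℕ ∘ mark) (mark-frame N∣2[1+r] N∣2[1+c]) v∈)) (markℤ-balanced (+ suc p) (+ suc q))

-- Near-perfect matchings of the grid

a≡#nearPerfect : ∀ r c h → a r c h ≡ Factors.#factors (vertices r c) (gridEdges r c) (nearPerfect h)
a≡#nearPerfect r c h =
  trans (length-filterᵇ _ (subsets (gridEdges r c)))
        (∑-cong (subsets (gridEdges r c)) λ M → cong toℕ (allB-cong (at M) (vertices r c)))
  where
  at : ∀ M v → (if v ≟v h then degIn M v ≡ᵇ 0 else degIn M v ≡ᵇ 1)
             ≡ does (+ degIn M v ℤ.≟ + 1 - + toℕ (v ≟v h))
  at M v with v ≟v h
  ... | true  = refl
  ... | false = refl

∣gcd⇒≤ : ∀ r c {d} → d ∣ gcd (r + 1) (c + 1) → d ≤ gcd (r + 1) (c + 1)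
∣gcd⇒≤ r c = ∣⇒≤ {{≢-nonZero (gcd[m,n]≢0 (r + 1) (c + 1) (inj₁ (ℕ.m<n⇒n≢0 (ℕ.m<m+n r (s≤s z≤n)))))}}

2∣a : ∀ r c {i j} → 2 < gcd (r + 1) (c + 1) → (i + j) % 2 ≡ 0 → 2 ∣ a r c (i , j)
2∣a r c {i} {j} 2<g white =
  subst (2 ∣_) (sym (a≡#nearPerfect r c (i , j)))
    (nearPerfect-even mark (mark-balanced (N∣double g∣1+r) (N∣double g∣1+c)) h-unmarked 1,2∈V (mark-1-2 4<N))
  where
  g : ℕ
  g = gcd (r + 1) (c + 1)

  N : ℕ
  N = 2 * g
  open Marking N
  open SimpleGraph (vertices r c) (vertices-unique r c) (gridEdges r c) (gridEdges-proper r c)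

  2∣N : 2 ∣ N
  2∣N = m∣m*n g

  h-unmarked : mark (i , j) ≡ false
  h-unmarked = markℤ-even 2∣N (+ i) (+ j) (ℤ.∣ᵤ⇒∣ (m%n≡0⇒n∣m (i + j) 2 white))

  g∣1+r : g ∣ suc r
  g∣1+r = subst (g ∣_) (ℕ.+-comm r 1) (gcd[m,n]∣m (r + 1) (c + 1))

  g∣1+c : g ∣ suc c
  g∣1+c = subst (g ∣_) (ℕ.+-comm c 1) (gcd[m,n]∣n (r + 1) (c + 1))

  N∣double : ∀ {n} → g ∣ n → + N ∣ℤ + n ℤ.+ + n
  N∣double {n} g∣n = ℤ.∣ᵤ⇒∣ (subst (N ∣_) (cong (λ m → n + m) (ℕ.+-identityʳ n)) (*-monoʳ-∣ 2 g∣n))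

  2≤r : 2 ≤ r
  2≤r = ℕ.≤-pred (ℕ.≤-trans 2<g (∣⇒≤ g∣1+r))

  2≤c : 2 ≤ c
  2≤c = ℕ.≤-pred (ℕ.≤-trans 2<g (∣⇒≤ g∣1+c))

  1,2∈V : (1 , 2) ∈ vertices r c
  1,2∈V = ∈-vertices⁺ (∈-range1⁺ (s≤s z≤n) (ℕ.≤-trans (s≤s z≤n) 2≤r)) (∈-range1⁺ (s≤s z≤n) 2≤c)

  4<N : 4 < N
  4<N = ℕ.<-≤-trans (s≤s (s≤s (s≤s (s≤s (s≤s z≤n))))) (ℕ.*-monoʳ-≤ 2 2<g)

4∣1+ : ∀ n → n % 4 ≡ 3 → 4 ∣ n + 1
4∣1+ n n%4≡3 = m%n≡0⇒n∣m (n + 1) 4 (trans (%-distribˡ-+ n 1 4) (cong (λ m → (m + 1 % 4) % 4) n%4≡3))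

odd>1⇒>2 : ∀ {f} → f % 2 ≡ 1 → 1 < f → 2 < f
odd>1⇒>2 {1}                 _ (s≤s ())
odd>1⇒>2 {suc (suc (suc _))} _ _ = s≤s (s≤s (s≤s z≤n))

lemma7 : (r c i j : ℕ) → r % 2 ≡ 1 → c % 2 ≡ 1
         → 1 ≤ i → i ≤ r → 1 ≤ j → j ≤ c → (i + j) % 2 ≡ 0
         → ((r % 4 ≡ 3 → c % 4 ≡ 3 → 2 ∣ a r c (i , j))
           × ((∃[ f ] (f % 2 ≡ 1 × 1 < f × f ∣ gcd (r + 1) (c + 1))) → 2 ∣ a r c (i , j)))
lemma7 r c i j _ _ _ _ _ _ white =
    (λ r≡3 c≡3 → 2∣a r c (ℕ.<-≤-trans 2<4 (∣gcd⇒≤ r c (gcd-greatest (4∣1+ r r≡3) (4∣1+ c c≡3)))) white)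
  , (λ (f , f-odd , 1<f , f∣g) → 2∣a r c (ℕ.<-≤-trans (odd>1⇒>2 f-odd 1<f) (∣gcd⇒≤ r c f∣g)) white)
  where
  2<4 : 2 < 4
  2<4 = s≤s (s≤s (s≤s z≤n))
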